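{- Consider the matrices $$M(b_1,\dots,b_6)=\begin{pmatrix} b_1&0&-1&0&0&0\\0&b_2&-1&0&0&0\\-1&-1&b_3&-1&0&0\\0&0&-1&b_4&-1&-1\\0&0&0&-1&b_5&0\\0&0&0&-1&0&b_6\end{pmatrix},\qquad b_1,\dots,b_6\in\mathbb Z,$$ with $b_j\ge2$ for $j\in\{1,2,5,6\}$, which are positive definite and unimodular (determinant $1$). Up to equivalence there are precisely $39$ such matrices.
   Context: $M$ is the plumbing (linking) matrix of the {\tt H}-graph: the tree on vertices $1,\dots,6$ with edges $1\!-\!3$, $2\!-\!3$, $3\!-\!4$, $4\!-\!5$, $4\!-\!6$, vertex $j$ labeled by $b_j$. Two such matrices are equivalent if there is an automorphism of this graph mapping one labeling to the other; the automorphism group is generated by swapping $b_1\leftrightarrow b_2$, swapping $b_5\leftrightarrow b_6$, and the swap $(b_1,b_2,b_3,b_4,b_5,b_6)\mapsto(b_5,b_6,b_4,b_3,b_1,b_2)$. -}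

module Defs where

open import Data.Nat using (ℕ; zero; suc)
open import Data.Integer using (ℤ; +_; -_; _+_; _*_; _≤_; _<_)
open import Data.Fin using (Fin; zero; suc; punchIn)
open import Data.Product using (Σ; _×_; _,_; ∃)
open import Data.List using (List; length)
open import Data.List.Membership.Propositional using (_∈_)
open import Data.List.Relation.Unary.AllPairs using (AllPairs)
open import Data.List.Relation.Unary.All using (All)
open import Relation.Binary.PropositionalEquality using (_≡_; _≢_)
open import Relation.Nullary using (¬_)

Matrix : ℕ → Set
Matrix n = Fin n → Fin n → ℤ

Vector : ℕ → Set
Vector n = Fin n → ℤ

sumFin : (n : ℕ) → (Fin n → ℤ) → ℤ
sumFin zero    f = + 0
sumFin (suc n) f = f zero + sumFin n (λ i → f (suc i))

sign : ℕ → ℤ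
sign zero          = + 1
sign (suc zero)    = - (+ 1)
sign (suc (suc k)) = sign k

toℕF : {n : ℕ} → Fin n → ℕ
toℕF zero    = zero
toℕF (suc i) = suc (toℕF i)

det : (n : ℕ) → Matrix n → ℤ
det zero    A = + 1
det (suc n) A =
  sumFin (suc n) (λ j → sign (toℕF j) * (A zero j *
    det n (λ r c → A (suc r) (punchIn j c))))

quad : (n : ℕ) → Matrix n → Vector n → ℤ
quad n A x = sumFin n (λ i → sumFin n (λ j → x i * (A i j * x j)))

PosDef : (n : ℕ) → Matrix n → Set
PosDef n A = (x : Vector n) → ∃ (λ i → x i ≢ + 0) → + 0 < quad n A x

record Labels : Set where
  constructor lab
  field
    b1 b2 b3 b4 b5 b6 : ℤ
open Labels public

-- the plumbing matrix of the H-graph: edges 1-3, 2-3, 3-4, 4-5, 4-6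
HMatrix : Labels → Matrix 6
HMatrix (lab b₁ b₂ b₃ b₄ b₅ b₆) = M
  where
  m1 : ℤ
  m1 = - (+ 1)
  M : Matrix 6
  M zero zero = b₁
  M zero (suc (suc zero)) = m1
  M (suc zero) (suc zero) = b₂
  M (suc zero) (suc (suc zero)) = m1
  M (suc (suc zero)) zero = m1
  M (suc (suc zero)) (suc zero) = m1
  M (suc (suc zero)) (suc (suc zero)) = b₃
  M (suc (suc zero)) (suc (suc (suc zero))) = m1
  M (suc (suc (suc zero))) (suc (suc zero)) = m1
  M (suc (suc (suc zero))) (suc (suc (suc zero))) = b₄
  M (suc (suc (suc zero))) (suc (suc (suc (suc zero)))) = m1
  M (suc (suc (suc zero))) (suc (suc (suc (suc (suc zero))))) = m1
  M (suc (suc (suc (suc zero)))) (suc (suc (suc zero))) = m1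
  M (suc (suc (suc (suc zero)))) (suc (suc (suc (suc zero)))) = b₅
  M (suc (suc (suc (suc (suc zero))))) (suc (suc (suc zero))) = m1
  M (suc (suc (suc (suc (suc zero))))) (suc (suc (suc (suc (suc zero))))) = b₆
  M _ _ = + 0

Admissible : Labels → Set
Admissible b =
  (+ 2 ≤ b1 b) × (+ 2 ≤ b2 b) × (+ 2 ≤ b5 b) × (+ 2 ≤ b6 b) ×
  PosDef 6 (HMatrix b) × (det 6 (HMatrix b) ≡ + 1)

-- generators of the automorphism group of the H-graph acting on labelings
data Step : Labels → Labels → Set where
  swap12 : ∀ {a b c d e f} → Step (lab a b c d e f) (lab b a c d e f)
  swap56 : ∀ {a b c d e f} → Step (lab a b c d e f) (lab a b c d f e)
  flipH  : ∀ {a b c d e f} → Step (lab a b c d e f) (lab e f d c a b)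

data Equiv : Labels → Labels → Set where
  eq-refl  : ∀ {x} → Equiv x x
  eq-step  : ∀ {x y z} → Step x y → Equiv y z → Equiv x z
  eq-stepᵒ : ∀ {x y z} → Step y x → Equiv y z → Equiv x z

ExactlyClasses : ℕ → Set
ExactlyClasses k =
  Σ (List Labels) λ reps →
    (length reps ≡ k) ×
    All Admissible reps ×
    AllPairs (λ x y → ¬ Equiv x y) reps ×
    ((b : Labels) → Admissible b → ∃ λ r → (r ∈ reps) × Equiv b r)

{-# OPTIONS --safe #-}
-- Write P = abc − a − b and Q = efd − e − f for the two arms of the H-graph. Expanding, det = PQ − abef,
-- and completing squares shows that for a, b, e, f > 0 the matrix is positive definite exactly when P > 0
-- and det > 0. So we must solve PQ = abef + 1 with P, Q > 0. If both centres c, d were at least 2 then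
-- P ≥ ab and Q ≥ ef, which is impossible; hence, up to the automorphisms, c = 1, a ≤ b and e ≤ f.
-- Comparing PQ with abef then bounds a ≤ 14 and d ≤ 7. The equation is linear in b and in f separately,
-- and a short case analysis bounds e together with b or with f in terms of (a, d), the remaining label
-- being forced; a finite search then finds the 39 solutions, which an automorphism-invariant weight of
-- the two arms tells apart.
module Submission where

open import Defs
open import Algebra.Bundles using (RawRing)
open import Data.Product using (_,_)
open import Level using (0ℓ)
open import Relation.Binary.PropositionalEquality using (refl)

module WeightedSquares (R : RawRing 0ℓ 0ℓ) where

  open import Data.List using (List; []; _∷_)
  open import Data.Product using (_×_)
  open RawRing R

  weightedSquares : List (Carrier × Carrier) → Carrier
  weightedSquares [] = 0#
  weightedSquares ((c , x) ∷ cxs) = c * (x * x) + weightedSquares cxs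

  -- Completing squares: x, y against z, then z against w, then p, q against w; the last weight is ab · det.
  HMatrix-squares : (a b c d e f x y z w p q : Carrier) → List (Carrier × Carrier)
  HMatrix-squares a b c d e f x y z w p q =
    (e * f * P * b , a * x + - z) ∷ (e * f * P * a , b * y + - z) ∷ (e * f , P * z + - (a * b * w)) ∷
    (a * b * P * f , e * p + - w) ∷ (a * b * P * e , f * q + - w) ∷ (a * b * (P * Q + - (a * b * (e * f))) , w) ∷ []
    where
    P Q : Carrier
    P = a * b * c + - a + - b
    Q = e * f * d + - e + - f

module HMatrixAlgebra where

  open import Data.Fin using (Fin; zero; suc; punchIn)
  open import Data.Integer hiding (_⊖_; suc; sign)
  open import Data.Integer.Tactic.RingSolver using (ring)
  open import Data.Nat as ℕ using (ℕ)
  open import Data.Vec using (_∷_; []; lookup)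
  open import Relation.Binary.PropositionalEquality using (_≡_; refl)
  open import Tactic.RingSolver.NonReflective ring using (Expr; Κ; _⊕_; _⊗_; ⊝_; solve; _⊜_)

  -- Copies of sumFin, det, quad and HMatrix over the ring solver's expressions. Evaluated, they unfold to
  -- exactly the same terms as the originals, so that solve can normalise det and quad. A literal zero factor
  -- is dropped (⊗₀), which is harmless because + 0 * i reduces to + 0, and keeps the normal forms small.
  private
    Poly : ℕ → Set
    Poly = Expr ℤ

    infixl 6 _⊖_
    _⊖_ : ∀ {n} → Poly n → Poly n → Poly n
    x ⊖ y = x ⊕ ⊝ y

    infixl 7 _⊗₀_
    _⊗₀_ : ∀ {n} → Poly n → Poly n → Poly n
    Κ +0 ⊗₀ y = Κ +0
    x ⊗₀ y = x ⊗ y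

    sumᴾ : ∀ {m} n → (Fin n → Poly m) → Poly m
    sumᴾ ℕ.zero f = Κ (+ 0)
    sumᴾ (ℕ.suc n) f = f zero ⊕ sumᴾ n (λ i → f (suc i))

    detᴾ : ∀ {m} n → (Fin n → Fin n → Poly m) → Poly m
    detᴾ ℕ.zero A = Κ (+ 1)
    detᴾ (ℕ.suc n) A =
      sumᴾ (ℕ.suc n) (λ j → Κ (sign (toℕF j)) ⊗ (A zero j ⊗₀ detᴾ n (λ r c → A (suc r) (punchIn j c))))

    quadᴾ : ∀ {m} n → (Fin n → Fin n → Poly m) → (Fin n → Poly m) → Poly m
    quadᴾ n A x = sumᴾ n (λ i → sumᴾ n (λ j → x i ⊗ (A i j ⊗₀ x j)))

    polyRawRing : ℕ → RawRing 0ℓ 0ℓ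
    polyRawRing n = record { Carrier = Poly n ; _≈_ = _≡_ ; _+_ = _⊕_ ; _*_ = _⊗_ ; -_ = ⊝_ ; 0# = Κ 0ℤ ; 1# = Κ 1ℤ }

    HMatrixᴾ : ∀ {m} → (a b c d e f : Poly m) → Fin 6 → Fin 6 → Poly m
    HMatrixᴾ {m} a b c d e f = M
      where
      M : Fin 6 → Fin 6 → Poly m
      M zero zero = a
      M zero (suc (suc zero)) = Κ (- (+ 1))
      M (suc zero) (suc zero) = b
      M (suc zero) (suc (suc zero)) = Κ (- (+ 1))
      M (suc (suc zero)) zero = Κ (- (+ 1))
      M (suc (suc zero)) (suc zero) = Κ (- (+ 1))
      M (suc (suc zero)) (suc (suc zero)) = c
      M (suc (suc zero)) (suc (suc (suc zero))) = Κ (- (+ 1))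
      M (suc (suc (suc zero))) (suc (suc zero)) = Κ (- (+ 1))
      M (suc (suc (suc zero))) (suc (suc (suc zero))) = d
      M (suc (suc (suc zero))) (suc (suc (suc (suc zero)))) = Κ (- (+ 1))
      M (suc (suc (suc zero))) (suc (suc (suc (suc (suc zero))))) = Κ (- (+ 1))
      M (suc (suc (suc (suc zero)))) (suc (suc (suc zero))) = Κ (- (+ 1))
      M (suc (suc (suc (suc zero)))) (suc (suc (suc (suc zero)))) = e
      M (suc (suc (suc (suc (suc zero))))) (suc (suc (suc zero))) = Κ (- (+ 1))
      M (suc (suc (suc (suc (suc zero))))) (suc (suc (suc (suc (suc zero))))) = f
      M _ _ = Κ (+ 0)

    module WSᴾ = WeightedSquares (polyRawRing 12)

  open WeightedSquares +-*-rawRing public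

  det-HMatrix : ∀ a b c d e f →
    det 6 (HMatrix (lab a b c d e f)) ≡ (a * b * c - a - b) * (e * f * d - e - f) - a * b * (e * f)
  det-HMatrix = solve 6 (λ a b c d e f →
    detᴾ 6 (HMatrixᴾ a b c d e f) ⊜ ((a ⊗ b ⊗ c ⊖ a ⊖ b) ⊗ (e ⊗ f ⊗ d ⊖ e ⊖ f) ⊖ a ⊗ b ⊗ (e ⊗ f))) refl

  quad-HMatrix-left : ∀ a b c d e f →
    quad 6 (HMatrix (lab a b c d e f)) (lookup (b ∷ a ∷ a * b ∷ 0ℤ ∷ 0ℤ ∷ 0ℤ ∷ []))
      ≡ a * b * (a * b * c - a - b)
  quad-HMatrix-left = solve 6 (λ a b c d e f →
    quadᴾ 6 (HMatrixᴾ a b c d e f) (lookup (b ∷ a ∷ a ⊗ b ∷ Κ 0ℤ ∷ Κ 0ℤ ∷ Κ 0ℤ ∷ []))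
      ⊜ (a ⊗ b ⊗ (a ⊗ b ⊗ c ⊖ a ⊖ b))) refl

  quad-HMatrix-right : ∀ a b c d e f →
    quad 6 (HMatrix (lab a b c d e f)) (lookup (0ℤ ∷ 0ℤ ∷ 0ℤ ∷ e * f ∷ f ∷ e ∷ []))
      ≡ e * f * (e * f * d - e - f)
  quad-HMatrix-right = solve 6 (λ a b c d e f →
    quadᴾ 6 (HMatrixᴾ a b c d e f) (lookup (Κ 0ℤ ∷ Κ 0ℤ ∷ Κ 0ℤ ∷ e ⊗ f ∷ f ∷ e ∷ []))
      ⊜ (e ⊗ f ⊗ (e ⊗ f ⊗ d ⊖ e ⊖ f))) refl

  quad-HMatrix-weightedSquares : ∀ a b c d e f x y z w p q →
    a * b * (e * f) * (a * b * c - a - b) * quad 6 (HMatrix (lab a b c d e f)) (lookup (x ∷ y ∷ z ∷ w ∷ p ∷ q ∷ []))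
      ≡ weightedSquares (HMatrix-squares a b c d e f x y z w p q)
  quad-HMatrix-weightedSquares = solve 12 (λ a b c d e f x y z w p q →
    a ⊗ b ⊗ (e ⊗ f) ⊗ (a ⊗ b ⊗ c ⊖ a ⊖ b) ⊗ quadᴾ 6 (HMatrixᴾ a b c d e f) (lookup (x ∷ y ∷ z ∷ w ∷ p ∷ q ∷ []))
    ⊜ WSᴾ.weightedSquares (WSᴾ.HMatrix-squares a b c d e f x y z w p q)) refl

module PositiveDefiniteness where

  open HMatrixAlgebra
  open import Data.Empty using (⊥-elim)
  open import Data.Fin using (zero; suc)
  open import Data.Integer hiding (suc)
  open import Data.Integer.Properties
  open import Data.List using ([]; _∷_)
  open import Data.List.Relation.Unary.All using (All; []; _∷_)
  open import Data.Nat using (z≤n; s≤s)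
  open import Data.Product using (_,_; proj₁; proj₂)
  open import Data.Sum using (inj₁; inj₂)
  open import Data.Vec using (_∷_; []; lookup)
  open import Function using (_∘_)
  open import Relation.Binary.PropositionalEquality
  open import Relation.Nullary using (¬_; yes; no)

  square-nonNeg : ∀ i → 0ℤ ≤ i * i
  square-nonNeg (+ n) = subst (0ℤ ≤_) (pos-* n n) (+≤+ z≤n)
  square-nonNeg -[1+ n ] = +≤+ z≤n

  square-pos : ∀ {i} → i ≢ 0ℤ → 0ℤ < i * i
  square-pos {+0} i≢0 = ⊥-elim (i≢0 refl)
  square-pos {+[1+ n ]} _ = +<+ (s≤s z≤n)
  square-pos { -[1+ n ]} _ = +<+ (s≤s z≤n)

  pos*pos : ∀ {i j} → 0ℤ < i → 0ℤ < j → 0ℤ < i * j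
  pos*pos (+<+ (s≤s z≤n)) (+<+ (s≤s z≤n)) = +<+ (s≤s z≤n)

  nonNeg*nonNeg : ∀ {i j} → 0ℤ ≤ i → 0ℤ ≤ j → 0ℤ ≤ i * j
  nonNeg*nonNeg {+ m} {+ n} _ _ = subst (0ℤ ≤_) (pos-* m n) (+≤+ z≤n)

  weightedSquares-nonNeg : ∀ {cxs} → All ((0ℤ <_) ∘ proj₁) cxs → 0ℤ ≤ weightedSquares cxs
  weightedSquares-nonNeg [] = ≤-refl
  weightedSquares-nonNeg {(_ , x) ∷ _} (0<c ∷ 0<cs) =
    +-mono-≤ (nonNeg*nonNeg (<⇒≤ 0<c) (square-nonNeg x)) (weightedSquares-nonNeg 0<cs)

  weightedSquares-pos : ∀ {cxs} → All ((0ℤ <_) ∘ proj₁) cxs → ¬ All ((_≡ 0ℤ) ∘ proj₂) cxs →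
    0ℤ < weightedSquares cxs
  weightedSquares-pos [] notAllZero = ⊥-elim (notAllZero [])
  weightedSquares-pos {(_ , x) ∷ _} (0<c ∷ 0<cs) notAllZero with x ≟ 0ℤ
  ... | yes x≡0 = +-mono-≤-< (nonNeg*nonNeg (<⇒≤ 0<c) (square-nonNeg x))
                    (weightedSquares-pos 0<cs (notAllZero ∘ (x≡0 ∷_)))
  ... | no x≢0 = +-mono-<-≤ (pos*pos 0<c (square-pos x≢0)) (weightedSquares-nonNeg 0<cs)

  pos*-cancelˡ : ∀ {i j} → 0ℤ < i → 0ℤ < i * j → 0ℤ < j
  pos*-cancelˡ {j = +[1+ _ ]} _ _ = +<+ (s≤s z≤n)
  pos*-cancelˡ {i} {+0} _ 0<i*0 = ⊥-elim (<-irrefl (sym (*-zeroʳ i)) 0<i*0)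
  pos*-cancelˡ {j = -[1+ _ ]} (+<+ (s≤s z≤n)) ()

  pos⇒≢0 : ∀ {i} → 0ℤ < i → i ≢ 0ℤ
  pos⇒≢0 0<i refl = <-irrefl refl 0<i

  factor-zero : ∀ {i j k} → 0ℤ < i → i * j - k ≡ 0ℤ → k ≡ 0ℤ → j ≡ 0ℤ
  factor-zero {i} {j} 0<i ij-k≡0 refl with i*j≡0⇒i≡0∨j≡0 i (trans (sym (+-identityʳ (i * j))) ij-k≡0)
  ... | inj₁ i≡0 = ⊥-elim (pos⇒≢0 0<i i≡0)
  ... | inj₂ j≡0 = j≡0

  module _ {a b c d e f : ℤ} (0<a : 0ℤ < a) (0<b : 0ℤ < b) (0<e : 0ℤ < e) (0<f : 0ℤ < f) where

    posDef-HMatrix⇒left : PosDef 6 (HMatrix (lab a b c d e f)) → 0ℤ < a * b * c - a - b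
    posDef-HMatrix⇒left posDef = pos*-cancelˡ (pos*pos 0<a 0<b)
      (subst (0ℤ <_) (quad-HMatrix-left a b c d e f)
        (posDef (lookup (b ∷ a ∷ a * b ∷ 0ℤ ∷ 0ℤ ∷ 0ℤ ∷ [])) (zero , pos⇒≢0 0<b)))

    posDef-HMatrix⇒right : PosDef 6 (HMatrix (lab a b c d e f)) → 0ℤ < e * f * d - e - f
    posDef-HMatrix⇒right posDef = pos*-cancelˡ (pos*pos 0<e 0<f)
      (subst (0ℤ <_) (quad-HMatrix-right a b c d e f) (posDef (lookup (0ℤ ∷ 0ℤ ∷ 0ℤ ∷ e * f ∷ f ∷ e ∷ []))
        (suc (suc (suc (suc zero))) , pos⇒≢0 0<f)))

    HMatrix-posDef : 0ℤ < a * b * c - a - b → 0ℤ < det 6 (HMatrix (lab a b c d e f)) →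
      PosDef 6 (HMatrix (lab a b c d e f))
    HMatrix-posDef 0<P 0<det X (i , Xi≢0) =
      pos*-cancelˡ scale-pos (subst (0ℤ <_) (sym (quad-HMatrix-weightedSquares a b c d e f x y z w p q))
        (weightedSquares-pos weights-pos notAllZero))
      where
      x y z w p q P ab ef : ℤ
      x = X zero
      y = X (suc zero)
      z = X (suc (suc zero))
      w = X (suc (suc (suc zero)))
      p = X (suc (suc (suc (suc zero))))
      q = X (suc (suc (suc (suc (suc zero)))))
      P = a * b * c - a - b
      ab = a * b
      ef = e * f

      0<ab : 0ℤ < ab
      0<ab = pos*pos 0<a 0<b

      0<ef : 0ℤ < ef
      0<ef = pos*pos 0<e 0<f

      scale-pos : 0ℤ < ab * ef * P
      scale-pos = pos*pos (pos*pos 0<ab 0<ef) 0<P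

      weights-pos : All ((0ℤ <_) ∘ proj₁) (HMatrix-squares a b c d e f x y z w p q)
      weights-pos = pos*pos (pos*pos 0<ef 0<P) 0<b ∷ pos*pos (pos*pos 0<ef 0<P) 0<a ∷ 0<ef
                  ∷ pos*pos (pos*pos 0<ab 0<P) 0<f ∷ pos*pos (pos*pos 0<ab 0<P) 0<e
                  ∷ pos*pos 0<ab (subst (0ℤ <_) (det-HMatrix a b c d e f) 0<det) ∷ []

      notAllZero : ¬ All ((_≡ 0ℤ) ∘ proj₂) (HMatrix-squares a b c d e f x y z w p q)
      notAllZero (ax-z≡0 ∷ by-z≡0 ∷ Pz-abw≡0 ∷ ep-w≡0 ∷ fq-w≡0 ∷ w≡0 ∷ []) = Xi≢0 (Xi≡0 i)
        where
        z≡0 : z ≡ 0ℤ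
        z≡0 = factor-zero 0<P Pz-abw≡0 (trans (cong (ab *_) w≡0) (*-zeroʳ ab))
        Xi≡0 : ∀ i → X i ≡ 0ℤ
        Xi≡0 zero = factor-zero 0<a ax-z≡0 z≡0
        Xi≡0 (suc zero) = factor-zero 0<b by-z≡0 z≡0
        Xi≡0 (suc (suc zero)) = z≡0
        Xi≡0 (suc (suc (suc zero))) = w≡0
        Xi≡0 (suc (suc (suc (suc zero)))) = factor-zero 0<e ep-w≡0 w≡0
        Xi≡0 (suc (suc (suc (suc (suc zero))))) = factor-zero 0<f fq-w≡0 w≡0

module NaturalSolutions where

  open import Data.Empty using (⊥-elim)
  open import Data.Nat
  open import Data.Nat.Properties
  open import Algebra.Properties.CommutativeSemigroup +-commutativeSemigroup using (xy∙z≈xz∙y)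
  open import Data.List using ([]; _∷_)
  open import Data.Nat.Tactic.RingSolver using (solve)
  open import Data.Sum using (_⊎_; inj₁; inj₂)
  open import Relation.Binary.PropositionalEquality

  -- An admissible labelling in natural numbers: P = abc − a − b and Q = efd − e − f, and det = PQ − abef.
  record Solution (a b c d e f : ℕ) : Set where
    field
      2≤a : 2 ≤ a
      2≤b : 2 ≤ b
      2≤e : 2 ≤ e
      2≤f : 2 ≤ f
      P Q : ℕ
      P+a+b : P + a + b ≡ a * b * c
      Q+e+f : Q + e + f ≡ e * f * d
      PQ≡ : P * Q ≡ a * b * (e * f) + 1

  factor-pos : ∀ {P Q N} → P * Q ≡ N + 1 → 0 < P
  factor-pos {P} {Q} {N} PQ≡ = n≢0⇒n>0 λ P≡0 → 0≢1+n (trans (sym (cong (_* Q) P≡0)) (trans PQ≡ (+-comm N 1)))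

  swap-ab : ∀ {a b c d e f} → Solution a b c d e f → Solution b a c d e f
  swap-ab {a} {b} {c} {d} {e} {f} s = record
    { Solution s
    ; 2≤a = 2≤b ; 2≤b = 2≤a
    ; P+a+b = trans (xy∙z≈xz∙y P b a) (trans P+a+b (cong (_* c) (*-comm a b)))
    ; PQ≡ = trans PQ≡ (cong (λ n → n * (e * f) + 1) (*-comm a b))
    }
    where open Solution s

  swap-ef : ∀ {a b c d e f} → Solution a b c d e f → Solution a b c d f e
  swap-ef {a} {b} {c} {d} {e} {f} s = record
    { Solution s
    ; 2≤e = 2≤f ; 2≤f = 2≤e
    ; Q+e+f = trans (xy∙z≈xz∙y Q f e) (trans Q+e+f (cong (_* d) (*-comm e f)))
    ; PQ≡ = trans PQ≡ (cong (λ n → a * b * n + 1) (*-comm e f))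
    }
    where open Solution s

  flip : ∀ {a b c d e f} → Solution a b c d e f → Solution e f d c a b
  flip {a} {b} {c} {d} {e} {f} s = record
    { 2≤a = 2≤e ; 2≤b = 2≤f ; 2≤e = 2≤a ; 2≤f = 2≤b
    ; P = Q ; Q = P ; P+a+b = Q+e+f ; Q+e+f = P+a+b
    ; PQ≡ = trans (*-comm Q P) (trans PQ≡ (cong (_+ 1) (*-comm (a * b) (e * f))))
    }
    where open Solution s

  m+n≤m*n : ∀ {m n} → 2 ≤ m → 2 ≤ n → m + n ≤ m * n
  m+n≤m*n {suc (suc m)} {suc (suc n)} (s≤s (s≤s _)) (s≤s (s≤s _)) = begin
    2 + m + (2 + n)                    ≤⟨ m≤m+n _ (m + n + m * n) ⟩
    2 + m + (2 + n) + (m + n + m * n)  ≡⟨ solve (m ∷ n ∷ []) ⟩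
    (2 + m) * (2 + n)                  ∎
    where open ≤-Reasoning

  long-arm : ∀ {a b c P} → 2 ≤ a → 2 ≤ b → 2 ≤ c → P + a + b ≡ a * b * c → a * b ≤ P
  long-arm {a} {b} {c} {P} 2≤a 2≤b 2≤c P+a+b≡ = +-cancelˡ-≤ (a + b) (a * b) P (begin
    a + b + a * b     ≤⟨ +-monoˡ-≤ (a * b) (m+n≤m*n 2≤a 2≤b) ⟩
    a * b + a * b     ≡⟨ trans (cong (a * b +_) (sym (*-identityʳ (a * b)))) (sym (*-suc (a * b) 1)) ⟩
    a * b * 2         ≤⟨ *-monoʳ-≤ (a * b) 2≤c ⟩
    a * b * c         ≡⟨ sym P+a+b≡ ⟩
    P + a + b         ≡⟨ trans (+-assoc P a b) (+-comm P (a + b)) ⟩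
    a + b + P         ∎)
    where open ≤-Reasoning

  empty-arm : ∀ a {b} P → 2 ≤ b → P + a + b ≢ a * b * 0
  empty-arm a {b} P 2≤b P+a+b≡ =
    <⇒≢ (≤-trans (s≤s z≤n) 2≤b) (sym (m+n≡0⇒n≡0 (P + a) (trans P+a+b≡ (*-zeroʳ (a * b)))))

  m+n≰m+1 : ∀ {m} n → 2 ≤ n → m + n ≰ m + 1
  m+n≰m+1 {m} n 2≤n m+n≤m+1 = <⇒≱ 2≤n (+-cancelˡ-≤ m n 1 m+n≤m+1)

  ≤⇒*≢*+1 : ∀ {X Y P Q} → 2 ≤ X → 2 ≤ Y → X ≤ P → Y ≤ Q → P * Q ≢ X * Y + 1
  ≤⇒*≢*+1 {X} {Y} {P} {Q} 2≤X 2≤Y X≤P Y≤Q PQ≡ with m≤n⇒m<n∨m≡n X≤P | m≤n⇒m<n∨m≡n Y≤Q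
  ... | inj₁ X<P | _ = m+n≰m+1 Y 2≤Y (begin
    X * Y + Y    ≡⟨ +-comm (X * Y) Y ⟩
    suc X * Y    ≤⟨ *-mono-≤ X<P Y≤Q ⟩
    P * Q        ≡⟨ PQ≡ ⟩
    X * Y + 1    ∎)
    where open ≤-Reasoning
  ... | inj₂ refl | inj₁ Y<Q = m+n≰m+1 X 2≤X (begin
    X * Y + X    ≡⟨ trans (+-comm (X * Y) X) (sym (*-suc X Y)) ⟩
    X * suc Y    ≤⟨ *-monoʳ-≤ X Y<Q ⟩
    X * Q        ≡⟨ PQ≡ ⟩
    X * Y + 1    ∎)
    where open ≤-Reasoning
  ... | inj₂ refl | inj₂ refl = m+1+n≢m (X * Y) (sym PQ≡)

  central-label-one : ∀ {a b c d e f} → Solution a b c d e f → c ≡ 1 ⊎ d ≡ 1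
  central-label-one {a} {c = 0} s = ⊥-elim (empty-arm a (Solution.P s) (Solution.2≤b s) (Solution.P+a+b s))
  central-label-one {c = 1} s = inj₁ refl
  central-label-one {d = 0} {e} s = ⊥-elim (empty-arm e (Solution.Q s) (Solution.2≤f s) (Solution.Q+e+f s))
  central-label-one {d = 1} s = inj₂ refl
  central-label-one {c = suc (suc _)} {d = suc (suc _)} s = ⊥-elim
    (≤⇒*≢*+1 (2≤*2≤ 2≤a 2≤b) (2≤*2≤ 2≤e 2≤f)
      (long-arm 2≤a 2≤b (s≤s (s≤s z≤n)) P+a+b) (long-arm 2≤e 2≤f (s≤s (s≤s z≤n)) Q+e+f) PQ≡)
    where
    open Solution s
    2≤*2≤ : ∀ {m n} → 2 ≤ m → 2 ≤ n → 2 ≤ m * n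
    2≤*2≤ 2≤m 2≤n = ≤-trans (m≤m+n 2 2) (*-mono-≤ 2≤m 2≤n)

  centre-one⇒other-centre≥2 : ∀ {a b d e f} → Solution a b 1 d e f → 2 ≤ d
  centre-one⇒other-centre≥2 {d = 0} {e} s = ⊥-elim (empty-arm e (Solution.Q s) (Solution.2≤f s) (Solution.Q+e+f s))
  centre-one⇒other-centre≥2 {a} {b} {1} {e} {f} s = ⊥-elim (m+1+n≰m (a * b * (e * f)) (begin
    a * b * (e * f) + 1      ≡⟨ sym PQ≡ ⟩
    P * Q                    ≤⟨ *-mono-≤ (arm≤ P a b P+a+b) (arm≤ Q e f Q+e+f) ⟩
    a * b * 1 * (e * f * 1)  ≡⟨ cong₂ _*_ (*-identityʳ (a * b)) (*-identityʳ (e * f)) ⟩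
    a * b * (e * f)          ∎))
    where
    open ≤-Reasoning
    open Solution s
    arm≤ : ∀ P a b {n} → P + a + b ≡ n → P ≤ n
    arm≤ P a b refl = ≤-trans (m≤m+n P a) (m≤m+n (P + a) b)
  centre-one⇒other-centre≥2 {d = suc (suc _)} _ = s≤s (s≤s z≤n)

module AdmissibleLabellings where

  open HMatrixAlgebra
  open PositiveDefiniteness
  open NaturalSolutions
  open import Data.Empty using (⊥-elim)
  open import Data.Integer hiding (suc)
  open import Data.Integer.Properties
  open import Data.Integer.Tactic.RingSolver using (solve-∀)
  open import Data.Nat as ℕ using (z≤n; s≤s)
  import Data.Nat.Properties as ℕ
  open import Data.Product using (∃; ∃₂; _×_; _,_)
  open import Relation.Binary.PropositionalEquality
  open import Relation.Nullary using (yes; no)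

  pos-*³ : ∀ a b c → + a * + b * + c ≡ + (a ℕ.* b ℕ.* c)
  pos-*³ a b c = trans (cong (_* + c) (sym (pos-* a b))) (sym (pos-* (a ℕ.* b) c))

  arm-ℤ : ∀ a b c {P} → P ℕ.+ a ℕ.+ b ≡ a ℕ.* b ℕ.* c → + a * + b * + c - + a - + b ≡ + P
  arm-ℤ a b c {P} P+a+b≡ = begin
    + a * + b * + c - + a - + b    ≡⟨ cong (λ i → i - + a - + b) (pos-*³ a b c) ⟩
    + (a ℕ.* b ℕ.* c) - + a - + b  ≡⟨ cong (λ n → + n - + a - + b) (sym P+a+b≡) ⟩
    + (P ℕ.+ a ℕ.+ b) - + a - + b
      ≡⟨ cong (λ i → i - + a - + b) (trans (pos-+ (P ℕ.+ a) b) (cong (_+ + b) (pos-+ P a))) ⟩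
    + P + + a + + b - + a - + b    ≡⟨ cancel (+ P) (+ a) (+ b) ⟩
    + P                            ∎
    where
    open ≡-Reasoning
    cancel : ∀ i j k → i + j + k - j - k ≡ i
    cancel = solve-∀

  arms-formula : ∀ a b c d e f {P Q} → P ℕ.+ a ℕ.+ b ≡ a ℕ.* b ℕ.* c → Q ℕ.+ e ℕ.+ f ≡ e ℕ.* f ℕ.* d →
    (+ a * + b * + c - + a - + b) * (+ e * + f * + d - + e - + f) - + a * + b * (+ e * + f)
      ≡ + P * + Q - + (a ℕ.* b ℕ.* (e ℕ.* f))
  arms-formula a b c d e f {P} {Q} P+a+b≡ Q+e+f≡ = trans
    (cong₂ (λ i j → i * j - + a * + b * (+ e * + f)) (arm-ℤ a b c P+a+b≡) (arm-ℤ e f d Q+e+f≡))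
    (cong (λ n → + P * + Q - n)
      (trans (cong₂ _*_ (sym (pos-* a b)) (sym (pos-* e f))) (sym (pos-* (a ℕ.* b) (e ℕ.* f)))))

  unimodular-ℕ : ∀ P Q {N} → + P * + Q - + N ≡ 1ℤ → P ℕ.* Q ≡ N ℕ.+ 1
  unimodular-ℕ P Q {N} det≡1 = +-injective (begin
    + (P ℕ.* Q)            ≡⟨ pos-* P Q ⟩
    + P * + Q              ≡⟨ minus-plus (+ P * + Q) (+ N) ⟩
    + P * + Q - + N + + N  ≡⟨ cong (_+ + N) det≡1 ⟩
    1ℤ + + N               ≡⟨ +-comm 1ℤ (+ N) ⟩
    + (N ℕ.+ 1)            ∎)
    where
    open ≡-Reasoning
    minus-plus : ∀ i j → i ≡ i - j + j
    minus-plus = solve-∀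

  unimodular-ℤ : ∀ P Q {N} → P ℕ.* Q ≡ N ℕ.+ 1 → + P * + Q - + N ≡ 1ℤ
  unimodular-ℤ P Q {N} PQ≡ = begin
    + P * + Q - + N        ≡⟨ cong (_- + N) (trans (sym (pos-* P Q)) (cong +_ PQ≡)) ⟩
    + (N ℕ.+ 1) - + N      ≡⟨ plus-minus (+ N) ⟩
    1ℤ                     ∎
    where
    open ≡-Reasoning
    plus-minus : ∀ i → i + 1ℤ - i ≡ 1ℤ
    plus-minus = solve-∀

  natural-excess : ∀ n a b → 0ℤ < + n - + a - + b → ∃ λ P → P ℕ.+ a ℕ.+ b ≡ n
  natural-excess n a b 0<n-a-b with a ℕ.+ b ℕ.≤? n
  ... | yes a+b≤n = n ℕ.∸ (a ℕ.+ b) , trans (ℕ.+-assoc _ a b) (ℕ.m∸n+n≡m a+b≤n)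
  ... | no a+b≰n = ⊥-elim (<-irrefl refl (<-≤-trans 0<n-a-b (subst (_≤ 0ℤ) (sym n-a-b≡) neg-≤-pos)))
    where
    open ≡-Reasoning
    sub-sub : ∀ i j k → i - j - k ≡ i - (j + k)
    sub-sub = solve-∀
    n-a-b≡ : + n - + a - + b ≡ - + (a ℕ.+ b ℕ.∸ n)
    n-a-b≡ = begin
      + n - + a - + b    ≡⟨ sub-sub (+ n) (+ a) (+ b) ⟩
      + n - (+ a + + b)  ≡⟨ cong (λ i → + n - i) (sym (pos-+ a b)) ⟩
      + n - + (a ℕ.+ b)  ≡⟨ m-n≡m⊖n n (a ℕ.+ b) ⟩
      n ⊖ (a ℕ.+ b)      ≡⟨ ⊖-≰ a+b≰n ⟩
      - + (a ℕ.+ b ℕ.∸ n) ∎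

  central-nonNeg : ∀ {a b} c → 0ℤ < +[1+ a ] * +[1+ b ] * c - +[1+ a ] - +[1+ b ] → ∃ λ n → c ≡ + n
  central-nonNeg (+ n) _ = n , refl
  central-nonNeg -[1+ _ ] ()

  0<+ : ∀ {n} → 2 ℕ.≤ n → 0ℤ < + n
  0<+ (s≤s _) = +<+ (s≤s z≤n)

  arms⇒solution : ∀ {a b e f} c d → 2 ℕ.≤ a → 2 ℕ.≤ b → 2 ℕ.≤ e → 2 ℕ.≤ f →
    0ℤ < + a * + b * c - + a - + b → 0ℤ < + e * + f * d - + e - + f →
    (+ a * + b * c - + a - + b) * (+ e * + f * d - + e - + f) - + a * + b * (+ e * + f) ≡ 1ℤ →
    ∃₂ λ c′ d′ → c ≡ + c′ × d ≡ + d′ × Solution a b c′ d′ e f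
  arms⇒solution {a} {b} {e} {f} c d 2≤a@(s≤s _) 2≤b@(s≤s _) 2≤e@(s≤s _) 2≤f@(s≤s _) 0<left 0<right det≡1
    with c′ , refl ← central-nonNeg c 0<left
       | d′ , refl ← central-nonNeg d 0<right
    with P , P+a+b ← natural-excess (a ℕ.* b ℕ.* c′) a b
                       (subst (0ℤ <_) (cong (λ i → i - + a - + b) (pos-*³ a b c′)) 0<left)
       | Q , Q+e+f ← natural-excess (e ℕ.* f ℕ.* d′) e f
                       (subst (0ℤ <_) (cong (λ i → i - + e - + f) (pos-*³ e f d′)) 0<right)
    = c′ , d′ , refl , refl , record
      { 2≤a = 2≤a ; 2≤b = 2≤b ; 2≤e = 2≤e ; 2≤f = 2≤f
      ; P = P ; Q = Q ; P+a+b = P+a+b ; Q+e+f = Q+e+f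
      ; PQ≡ = unimodular-ℕ P Q (trans (sym (arms-formula a b c′ d′ e f P+a+b Q+e+f)) det≡1)
      }

  admissible⇒solution : ∀ {a b e f} c d → 2 ℕ.≤ a → 2 ℕ.≤ b → 2 ℕ.≤ e → 2 ℕ.≤ f →
    PosDef 6 (HMatrix (lab (+ a) (+ b) c d (+ e) (+ f))) →
    det 6 (HMatrix (lab (+ a) (+ b) c d (+ e) (+ f))) ≡ 1ℤ →
    ∃₂ λ c′ d′ → c ≡ + c′ × d ≡ + d′ × Solution a b c′ d′ e f
  admissible⇒solution {a} {b} {e} {f} c d 2≤a 2≤b 2≤e 2≤f posDef det≡1 = arms⇒solution c d 2≤a 2≤b 2≤e 2≤f
    (posDef-HMatrix⇒left {c = c} {d} (0<+ 2≤a) (0<+ 2≤b) (0<+ 2≤e) (0<+ 2≤f) posDef)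
    (posDef-HMatrix⇒right {c = c} {d} (0<+ 2≤a) (0<+ 2≤b) (0<+ 2≤e) (0<+ 2≤f) posDef)
    (trans (sym (det-HMatrix (+ a) (+ b) c d (+ e) (+ f))) det≡1)

  solution⇒admissible : ∀ {a b c d e f} → Solution a b c d e f → Admissible (lab (+ a) (+ b) (+ c) (+ d) (+ e) (+ f))
  solution⇒admissible {a} {b} {c} {d} {e} {f} sol =
    +≤+ 2≤a , +≤+ 2≤b , +≤+ 2≤e , +≤+ 2≤f ,
    HMatrix-posDef {c = + c} {+ d} (0<+ 2≤a) (0<+ 2≤b) (0<+ 2≤e) (0<+ 2≤f)
      (subst (0ℤ <_) (sym (arm-ℤ a b c P+a+b)) (+<+ (factor-pos PQ≡))) (subst (0ℤ <_) (sym det≡1) (+<+ (s≤s z≤n))) ,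
    det≡1
    where
    open Solution sol
    det≡1 : det 6 (HMatrix (lab (+ a) (+ b) (+ c) (+ d) (+ e) (+ f))) ≡ 1ℤ
    det≡1 = trans (det-HMatrix (+ a) (+ b) (+ c) (+ d) (+ e) (+ f))
              (trans (arms-formula a b c d e f P+a+b Q+e+f) (unimodular-ℤ P Q PQ≡))

module Search where

  open NaturalSolutions
  open import Data.Bool using (Bool; true; T; _∧_; _∨_; not)
  open import Data.Bool.Properties using (T-∧)
  open import Data.List using (List; []; _∷_)
  open import Data.List.Membership.Propositional using (_∈_)
  open import Data.Nat
  open import Data.Nat.DivMod using (_/_; m*n/n≡m; /-monoˡ-≤)
  open import Data.Nat.Properties
  open import Data.Product using (_×_; _,_; proj₁; proj₂)
  open import Data.Product.Properties using (≡-dec)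
  open import Data.Sum using (inj₁; inj₂)
  open import Function.Bundles using (Equivalence)
  open import Relation.Binary.Definitions using (DecidableEquality)
  open import Relation.Binary.PropositionalEquality
  open import Relation.Nullary.Decidable using (⌊_⌋; toWitness)

  -- (u , v , k , s , t) stands for the labelling (u, v, 1, k, s, t).
  Candidate : Set
  Candidate = ℕ × ℕ × ℕ × ℕ × ℕ

  solutions : List Candidate
  solutions =
    (2 , 3 , 7 , 2 , 3) ∷
    (2 , 5 , 4 , 2 , 7) ∷
    (2 , 7 , 3 , 6 , 31) ∷
    (2 , 7 , 3 , 7 , 18) ∷
    (2 , 9 , 3 , 3 , 11) ∷
    (2 , 11 , 3 , 2 , 19) ∷
    (2 , 27 , 3 , 2 , 3) ∷
    (3 , 4 , 3 , 2 , 11) ∷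
    (3 , 4 , 3 , 3 , 4) ∷
    (3 , 5 , 3 , 2 , 3) ∷
    (3 , 7 , 2 , 12 , 133) ∷
    (3 , 7 , 2 , 13 , 72) ∷
    (3 , 8 , 2 , 7 , 92) ∷
    (3 , 8 , 2 , 8 , 35) ∷
    (3 , 8 , 2 , 11 , 16) ∷
    (3 , 11 , 2 , 4 , 77) ∷
    (3 , 11 , 2 , 5 , 16) ∷
    (3 , 16 , 2 , 3 , 88) ∷
    (3 , 17 , 2 , 3 , 47) ∷
    (3 , 47 , 2 , 4 , 5) ∷
    (3 , 56 , 2 , 3 , 8) ∷
    (3 , 97 , 2 , 3 , 7) ∷
    (4 , 5 , 2 , 6 , 67) ∷
    (4 , 5 , 2 , 7 , 26) ∷
    (4 , 7 , 2 , 3 , 52) ∷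
    (4 , 9 , 2 , 3 , 10) ∷
    (4 , 13 , 2 , 2 , 71) ∷
    (4 , 17 , 2 , 2 , 19) ∷
    (4 , 23 , 2 , 3 , 4) ∷
    (4 , 25 , 2 , 2 , 11) ∷
    (4 , 77 , 2 , 2 , 7) ∷
    (5 , 7 , 2 , 3 , 7) ∷
    (5 , 8 , 2 , 2 , 55) ∷
    (5 , 9 , 2 , 2 , 21) ∷
    (5 , 16 , 2 , 2 , 7) ∷
    (5 , 33 , 2 , 2 , 5) ∷
    (8 , 57 , 2 , 2 , 3) ∷
    (9 , 32 , 2 , 2 , 3) ∷
    (12 , 17 , 2 , 2 , 3) ∷ []

  _≟ᶜ_ : DecidableEquality Candidate
  _≟ᶜ_ = ≡-dec _≟_ (≡-dec _≟_ (≡-dec _≟_ (≡-dec _≟_ _≟_)))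

  open import Data.List.Membership.DecPropositional _≟ᶜ_ using (_∈?_)

  -- ⌊ m / n ⌋, with the junk value 0 for n = 0
  infixl 7 _div_
  _div_ : ℕ → ℕ → ℕ
  m div zero = 0
  m div suc n = m / suc n

  div-exact : ∀ {m n q} → 1 ≤ n → q * n ≡ m → m div n ≡ q
  div-exact {n = suc n} {q} _ refl = m*n/n≡m q (suc n)

  ≤-div : ∀ {m n q} → 1 ≤ n → n * q ≤ m → q ≤ m div n
  ≤-div {m} {suc n} {q} _ n*q≤m =
    subst (_≤ m / suc n) (m*n/n≡m q (suc n)) (/-monoˡ-≤ (suc n) (subst (_≤ m) (*-comm (suc n) q) n*q≤m))

  allUpTo : ℕ → (ℕ → Bool) → Bool
  allUpTo zero p = p zero
  allUpTo (suc n) p = allUpTo n p ∧ p (suc n)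

  allUpTo-sound : ∀ {n p i} → T (allUpTo n p) → i ≤ n → T (p i)
  allUpTo-sound {zero} h z≤n = h
  allUpTo-sound {suc n} h i≤1+n with m≤n⇒m<n∨m≡n i≤1+n
  ... | inj₁ (s≤s i≤n) = allUpTo-sound (proj₁ (Equivalence.to T-∧ h)) i≤n
  ... | inj₂ refl = proj₂ (Equivalence.to T-∧ h)

  excess : ℕ → ℕ → ℕ → ℕ
  excess a b c = a * b * c ∸ a ∸ b

  isSolution : Candidate → Bool
  isSolution (u , v , k , s , t) =
    (2 ≤ᵇ u) ∧ (u ≤ᵇ v) ∧ (2 ≤ᵇ s) ∧ (s ≤ᵇ t) ∧ (excess u v 1 * excess s t k ≡ᵇ u * v * (s * t) + 1)

  excess+a+b : ∀ a b c → excess a b c ≢ 0 → excess a b c + a + b ≡ a * b * c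
  excess+a+b a b c excess≢0 = begin
    a * b * c ∸ a ∸ b + a + b      ≡⟨ +-assoc (a * b * c ∸ a ∸ b) a b ⟩
    a * b * c ∸ a ∸ b + (a + b)    ≡⟨ cong (_+ (a + b)) (∸-+-assoc (a * b * c) a b) ⟩
    a * b * c ∸ (a + b) + (a + b)
      ≡⟨ m∸n+n≡m {n = a + b} (<⇒≤ (m∸n≢0⇒n<m (subst (_≢ 0) (∸-+-assoc (a * b * c) a b) excess≢0))) ⟩
    a * b * c                      ∎
    where open ≡-Reasoning

  isSolution-sound : ∀ {u v k s t} → T (isSolution (u , v , k , s , t)) → Solution u v 1 k s t × u ≤ v × s ≤ t
  isSolution-sound {u} {v} {k} {s} {t} h
    with 2≤u , h₁ ← Equivalence.to T-∧ h
    with u≤v , h₂ ← Equivalence.to T-∧ h₁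
    with 2≤s , h₃ ← Equivalence.to T-∧ h₂
    with s≤t , PQ≡ᵇ ← Equivalence.to T-∧ h₃
    = record
      { 2≤a = ≤ᵇ⇒≤ 2 u 2≤u ; 2≤b = ≤-trans (≤ᵇ⇒≤ 2 u 2≤u) (≤ᵇ⇒≤ u v u≤v)
      ; 2≤e = ≤ᵇ⇒≤ 2 s 2≤s ; 2≤f = ≤-trans (≤ᵇ⇒≤ 2 s 2≤s) (≤ᵇ⇒≤ s t s≤t)
      ; P = excess u v 1 ; Q = excess s t k
      ; P+a+b = excess+a+b u v 1 (>⇒≢ (factor-pos PQ≡))
      ; Q+e+f = excess+a+b s t k (>⇒≢ (factor-pos (trans (*-comm (excess s t k) (excess u v 1)) PQ≡)))
      ; PQ≡ = PQ≡
      }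
    , ≤ᵇ⇒≤ u v u≤v , ≤ᵇ⇒≤ s t s≤t
    where
    PQ≡ : excess u v 1 * excess s t k ≡ u * v * (s * t) + 1
    PQ≡ = ≡ᵇ⇒≡ _ _ PQ≡ᵇ

  checked : Candidate → Bool
  checked c = not (isSolution c) ∨ ⌊ c ∈? solutions ⌋

  checked-sound : ∀ {c} → T (checked c) → T (isSolution c) → c ∈ solutions
  checked-sound {c} h sol = toWitness {a? = c ∈? solutions} (modus-ponens {isSolution c} h sol)
    where
    modus-ponens : ∀ {x y} → T (not x ∨ y) → T x → T y
    modus-ponens {true} y _ = y

  -- m = (u − 1)k − u and D = ms − (u − 1), both positive on solutions (see Bounds.SortedSolution).
  gap : ℕ → ℕ → ℕ
  gap u k = (u ∸ 1) * k ∸ u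

  gapₛ : ℕ → ℕ → ℕ → ℕ
  gapₛ u k s = gap u k * s ∸ (u ∸ 1)

  -- The value of t forced by (u, v, k, s), and the value of v forced by (u, k, s, t).
  tCandidate : ℕ → ℕ → ℕ → ℕ → ℕ
  tCandidate u v k s = (P * s + 1) div ((k * P ∸ u * v) * s ∸ P)
    where
    P : ℕ
    P = excess u v 1

  vCandidate : ℕ → ℕ → ℕ → ℕ → ℕ
  vCandidate u k s t = (u * excess s t k + 1) div (gapₛ u k s * t ∸ (u ∸ 1) * s)

  -- The three loops are the three cases of Bounds.SortedSolution.listed.
  searchFrom : ℕ → ℕ → Bool
  searchFrom u k =
    (allUpTo (2 * u * k div gap u k) λ v → allUpTo (2 * excess u v 1) λ s →
       checked (u , v , k , s , tCandidate u v k s))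
    ∧ (allUpTo ((4 * (u ∸ 1) ∸ 1) div gap u k) λ s →
         (allUpTo (2 * u * k * s div gapₛ u k s) λ v → checked (u , v , k , s , tCandidate u v k s))
       ∧ (allUpTo (2 * (u ∸ 1) * s div gapₛ u k s) λ t → checked (u , vCandidate u k s t , k , s , t)))

  search : Bool
  search = allUpTo 14 λ u → allUpTo 7 λ k → searchFrom u k

  search-succeeds : T search
  search-succeeds = _

  record Searched (u k : ℕ) : Set where
    field
      t-from-v,s : ∀ {v s} → v ≤ 2 * u * k div gap u k → s ≤ 2 * excess u v 1 →
                   T (checked (u , v , k , s , tCandidate u v k s))
      t-from-s,v : ∀ {s v} → s ≤ (4 * (u ∸ 1) ∸ 1) div gap u k → v ≤ 2 * u * k * s div gapₛ u k s →
                   T (checked (u , v , k , s , tCandidate u v k s))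
      v-from-s,t : ∀ {s t} → s ≤ (4 * (u ∸ 1) ∸ 1) div gap u k → t ≤ 2 * (u ∸ 1) * s div gapₛ u k s →
                   T (checked (u , vCandidate u k s t , k , s , t))

  search-sound : ∀ {u k} → u ≤ 14 → k ≤ 7 → Searched u k
  search-sound {u} {k} u≤14 k≤7 = record
    { t-from-v,s = λ v≤ s≤ → allUpTo-sound (allUpTo-sound (proj₁ (∧-split searched)) v≤) s≤
    ; t-from-s,v = λ s≤ v≤ → allUpTo-sound (proj₁ (∧-split (allUpTo-sound (proj₂ (∧-split searched)) s≤))) v≤
    ; v-from-s,t = λ s≤ t≤ → allUpTo-sound (proj₂ (∧-split (allUpTo-sound (proj₂ (∧-split searched)) s≤))) t≤
    }
    where
    ∧-split : ∀ {x y} → T (x ∧ y) → T x × T y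
    ∧-split = Equivalence.to T-∧
    searched : T (searchFrom u k)
    searched = allUpTo-sound {p = searchFrom u}
      (allUpTo-sound {p = λ u → allUpTo 7 (searchFrom u)} search-succeeds u≤14) k≤7

module Bounds where

  open NaturalSolutions
  open Search
  open import Data.Bool using (T)
  open import Data.Bool.Properties using (T-∧)
  open import Data.Empty using (⊥-elim)
  open import Data.List using (_∷_; [])
  open import Data.List.Membership.Propositional using (_∈_)
  open import Data.Nat
  open import Data.Nat.Properties
  open import Algebra.Properties.CommutativeSemigroup +-commutativeSemigroup using (xy∙z≈xz∙y)
  open import Data.Nat.Tactic.RingSolver using (solve)
  open import Data.Product using (_×_; _,_; proj₁; proj₂)
  open import Data.Sum using (inj₁; inj₂)
  open import Function.Bundles using (Equivalence)
  open import Relation.Binary.PropositionalEquality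
  open import Relation.Nullary using (Dec; yes; no)

  excess-≡ : ∀ P a b {c} → P + a + b ≡ a * b * c → excess a b c ≡ P
  excess-≡ P a b P+a+b≡ = begin
    a * b * _ ∸ a ∸ b  ≡⟨ cong (λ n → n ∸ a ∸ b) (trans (sym P+a+b≡) (xy∙z≈xz∙y P a b)) ⟩
    P + b + a ∸ a ∸ b  ≡⟨ cong (_∸ b) (m+n∸n≡m (P + b) a) ⟩
    P + b ∸ b          ≡⟨ m+n∸n≡m P b ⟩
    P                  ∎
    where open ≡-Reasoning

  exact-difference : ∀ x y z {r} → y * z ≡ x * z + suc r → 0 < y ∸ x × (y ∸ x) * z ≡ suc r
  exact-difference x y z {r} yz≡ = m<n⇒0<n∸m x<y , (begin
    (y ∸ x) * z        ≡⟨ *-distribʳ-∸ z y x ⟩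
    y * z ∸ x * z      ≡⟨ cong (_∸ x * z) yz≡ ⟩
    x * z + suc r ∸ x * z ≡⟨ m+n∸m≡n (x * z) (suc r) ⟩
    suc r              ∎)
    where
    open ≡-Reasoning
    x<y : x < y
    x<y with x <? y
    ... | yes x<y = x<y
    ... | no x≮y = ⊥-elim (m+1+n≰m (x * z) (subst (_≤ x * z) yz≡ (*-monoˡ-≤ z (≮⇒≥ x≮y))))

  -- Sharp at (a, b) = (2, 3).
  product≤6*excess : ∀ {a b x} → 2 ≤ a → a ≤ b → 1 ≤ x → x + a + b ≡ a * b → a * b ≤ 6 * x
  product≤6*excess {2} {b} {suc y} _ _ _ x+2+b≡2b
    with refl ← +-cancelʳ-≡ b (suc y + 2) b (trans x+2+b≡2b (cong (b +_) (+-identityʳ b)))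
    = begin
      2 * (suc y + 2)            ≤⟨ m≤m+n (2 * (suc y + 2)) (4 * y) ⟩
      2 * (suc y + 2) + 4 * y    ≡⟨ solve (y ∷ []) ⟩
      6 * suc y                  ∎
    where open ≤-Reasoning
  product≤6*excess {1} (s≤s ()) _ _ _
  product≤6*excess {suc (suc (suc i))} {x = x} _ a≤b _ x+a+b≡ab
    with j , refl ← m≤n⇒∃[o]m+o≡n a≤b
    = +-cancelʳ-≤ (6 * (3 + i) + 6 * (3 + i + j)) ((3 + i) * (3 + i + j)) (6 * x) (begin
      (3 + i) * (3 + i + j) + (6 * (3 + i) + 6 * (3 + i + j))
        ≤⟨ m≤m+n _ (9 + 18 * i + 9 * j + 5 * (i * i) + 5 * (i * j)) ⟩
      (3 + i) * (3 + i + j) + (6 * (3 + i) + 6 * (3 + i + j)) + (9 + 18 * i + 9 * j + 5 * (i * i) + 5 * (i * j))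
        ≡⟨ solve (i ∷ j ∷ []) ⟩
      6 * ((3 + i) * (3 + i + j))              ≡⟨ cong (6 *_) (sym x+a+b≡ab) ⟩
      6 * (x + (3 + i) + (3 + i + j))          ≡⟨ solve (x ∷ i ∷ j ∷ []) ⟩
      6 * x + (6 * (3 + i) + 6 * (3 + i + j))  ∎)
    where open ≤-Reasoning

  module SortedSolution {u v k s t P Q : ℕ}
    (2≤u : 2 ≤ u) (u≤v : u ≤ v) (2≤s : 2 ≤ s) (s≤t : s ≤ t) (2≤k : 2 ≤ k)
    (P+u+v : P + u + v ≡ u * v) (Q+s+t : Q + s + t ≡ s * t * k) (PQ≡ : P * Q ≡ u * v * (s * t) + 1)
    where

    2≤v : 2 ≤ v
    2≤v = ≤-trans 2≤u u≤v

    2≤t : 2 ≤ t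
    2≤t = ≤-trans 2≤s s≤t

    4≤st : 4 ≤ s * t
    4≤st = *-mono-≤ 2≤s 2≤t

    16≤uvst : 16 ≤ u * v * (s * t)
    16≤uvst = *-mono-≤ (*-mono-≤ 2≤u 2≤v) 4≤st

    s+t≤st : s + t ≤ s * t
    s+t≤st = m+n≤m*n 2≤s 2≤t

    1≤P : 1 ≤ P
    1≤P = factor-pos PQ≡

    uv≤6P : u * v ≤ 6 * P
    uv≤6P = product≤6*excess 2≤u u≤v 1≤P P+u+v

    st*k≤Q+st : s * t * k ≤ Q + s * t
    st*k≤Q+st = begin
      s * t * k    ≡⟨ sym Q+s+t ⟩
      Q + s + t    ≡⟨ +-assoc Q s t ⟩
      Q + (s + t)  ≤⟨ +-monoʳ-≤ Q s+t≤st ⟩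
      Q + s * t    ∎
      where open ≤-Reasoning

    k≤7 : k ≤ 7
    k≤7 with k ≤? 7
    ... | yes k≤7 = k≤7
    ... | no k≰7 = ⊥-elim (<⇒≱ (≤-trans (m≤m+n 7 9) 16≤uvst)
        (+-cancelˡ-≤ (6 * (u * v * (s * t))) (u * v * (s * t)) 6 (begin
          6 * (u * v * (s * t)) + u * v * (s * t)  ≡⟨ solve (u ∷ v ∷ s ∷ t ∷ []) ⟩
          u * v * (7 * (s * t))                    ≤⟨ *-mono-≤ uv≤6P 7st≤Q ⟩
          6 * P * Q                                ≡⟨ trans (*-assoc 6 P Q) (cong (6 *_) PQ≡) ⟩
          6 * (u * v * (s * t) + 1)                ≡⟨ *-distribˡ-+ 6 (u * v * (s * t)) 1 ⟩
          6 * (u * v * (s * t)) + 6                ∎)))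
      where
      open ≤-Reasoning
      7st≤Q : 7 * (s * t) ≤ Q
      7st≤Q = +-cancelʳ-≤ (s * t) (7 * (s * t)) Q (begin
        7 * (s * t) + s * t  ≡⟨ solve (s ∷ t ∷ []) ⟩
        s * t * 8            ≤⟨ *-monoʳ-≤ (s * t) (≰⇒> k≰7) ⟩
        s * t * k            ≤⟨ st*k≤Q+st ⟩
        Q + s * t            ∎)

    Q≢st : Q ≢ s * t
    Q≢st Q≡st = <⇒≱ 4≤st (≤-trans (≤-reflexive st≡1) (s≤s z≤n))
      where
      P*st≡ : P * (s * t) ≡ u * v * (s * t) + 1
      P*st≡ = trans (cong (P *_) (sym Q≡st)) PQ≡
      st≡1 : s * t ≡ 1
      st≡1 = m*n≡1⇒n≡1 (P ∸ u * v) (s * t) (proj₂ (exact-difference (u * v) P (s * t) P*st≡))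

    7st≤6Q : 7 * (s * t) ≤ 6 * Q
    7st≤6Q with m≤n⇒m<n∨m≡n 2≤k
    ... | inj₁ 3≤k = begin
        7 * (s * t)        ≤⟨ *-monoˡ-≤ (s * t) (m≤m+n 7 5) ⟩
        12 * (s * t)       ≡⟨ *-assoc 6 2 (s * t) ⟩
        6 * (2 * (s * t))  ≤⟨ *-monoʳ-≤ 6 2st≤Q ⟩
        6 * Q              ∎
      where
      open ≤-Reasoning
      2st≤Q : 2 * (s * t) ≤ Q
      2st≤Q = +-cancelʳ-≤ (s * t) (2 * (s * t)) Q (begin
        2 * (s * t) + s * t  ≡⟨ trans (+-comm (2 * (s * t)) (s * t)) (*-comm 3 (s * t)) ⟩
        s * t * 3            ≤⟨ *-monoʳ-≤ (s * t) 3≤k ⟩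
        s * t * k            ≤⟨ st*k≤Q+st ⟩
        Q + s * t            ∎)
    ... | inj₂ 2≡k = begin
        7 * (s * t)              ≡⟨ +-comm (s * t) (6 * (s * t)) ⟩
        6 * (s * t) + s * t      ≤⟨ +-monoʳ-≤ (6 * (s * t)) (product≤6*excess 2≤s s≤t 1≤x x+s+t) ⟩
        6 * (s * t) + 6 * x      ≡⟨ sym (*-distribˡ-+ 6 (s * t) x) ⟩
        6 * (s * t + x)          ≡⟨ cong (6 *_) st+x≡Q ⟩
        6 * Q                    ∎
      where
      open ≤-Reasoning
      st≤Q : s * t ≤ Q
      st≤Q = +-cancelʳ-≤ (s * t) (s * t) Q (begin
        s * t + s * t  ≡⟨ solve (s ∷ t ∷ []) ⟩
        s * t * 2      ≡⟨ cong (s * t *_) 2≡k ⟩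
        s * t * k      ≤⟨ st*k≤Q+st ⟩
        Q + s * t      ∎)
      x : ℕ
      x = Q ∸ s * t
      st+x≡Q : s * t + x ≡ Q
      st+x≡Q = m+[n∸m]≡n st≤Q
      1≤x : 1 ≤ x
      1≤x = n≢0⇒n>0 λ x≡0 → Q≢st (trans (sym st+x≡Q) (trans (cong (s * t +_) x≡0) (+-identityʳ (s * t))))
      x+s+t : x + s + t ≡ s * t
      x+s+t = +-cancelˡ-≡ (s * t) (x + s + t) (s * t) (begin-equality
        s * t + (x + s + t)  ≡⟨ cong (s * t +_) (+-assoc x s t) ⟩
        s * t + (x + (s + t)) ≡⟨ sym (trans (+-assoc (s * t + x) s t) (+-assoc (s * t) x (s + t))) ⟩
        s * t + x + s + t    ≡⟨ cong (λ q → q + s + t) st+x≡Q ⟩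
        Q + s + t            ≡⟨ Q+s+t ⟩
        s * t * k            ≡⟨ cong (s * t *_) (sym 2≡k) ⟩
        s * t * 2            ≡⟨ solve (s ∷ t ∷ []) ⟩
        s * t + s * t        ∎)

    -- 7st ≤ 6Q and uv ≤ P + 2v give 7uvst ≤ 6PQ + 14vst = 6uvst + 6 + 14vst.
    u≤14 : u ≤ 14
    u≤14 with u ≤? 14
    ... | yes u≤14 = u≤14
    ... | no u≰14 = ⊥-elim (<⇒≱ (≤-trans (m≤m+n 7 1) 8≤vst)
        (+-cancelˡ-≤ (6 * (u * v * (s * t)) + 14 * (v * (s * t))) (v * (s * t)) 6 (begin
          6 * (u * v * (s * t)) + 14 * (v * (s * t)) + v * (s * t)  ≡⟨ solve (u ∷ v ∷ s ∷ t ∷ []) ⟩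
          6 * (u * v * (s * t)) + 15 * (v * (s * t))
            ≤⟨ +-monoʳ-≤ (6 * (u * v * (s * t))) (*-monoˡ-≤ (v * (s * t)) (≰⇒> u≰14)) ⟩
          6 * (u * v * (s * t)) + u * (v * (s * t))                 ≡⟨ solve (u ∷ v ∷ s ∷ t ∷ []) ⟩
          7 * (u * v) * (s * t)                                     ≤⟨ *-monoˡ-≤ (s * t) (*-monoʳ-≤ 7 uv≤P+2v) ⟩
          7 * (P + 2 * v) * (s * t)                                 ≡⟨ solve (P ∷ v ∷ s ∷ t ∷ []) ⟩
          P * (7 * (s * t)) + 14 * (v * (s * t))
            ≤⟨ +-monoˡ-≤ (14 * (v * (s * t))) (*-monoʳ-≤ P 7st≤6Q) ⟩
          P * (6 * Q) + 14 * (v * (s * t))                          ≡⟨ solve (P ∷ Q ∷ v ∷ s ∷ t ∷ []) ⟩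
          6 * (P * Q) + 14 * (v * (s * t))                          ≡⟨ cong (λ n → 6 * n + 14 * (v * (s * t))) PQ≡ ⟩
          6 * (u * v * (s * t) + 1) + 14 * (v * (s * t))            ≡⟨ solve (u ∷ v ∷ s ∷ t ∷ []) ⟩
          6 * (u * v * (s * t)) + 14 * (v * (s * t)) + 6            ∎)))
      where
      open ≤-Reasoning
      8≤vst : 8 ≤ v * (s * t)
      8≤vst = *-mono-≤ 2≤v 4≤st
      uv≤P+2v : u * v ≤ P + 2 * v
      uv≤P+2v = begin
        u * v      ≡⟨ sym P+u+v ⟩
        P + u + v  ≤⟨ +-monoˡ-≤ v (+-monoʳ-≤ P u≤v) ⟩
        P + v + v  ≡⟨ solve (P ∷ v ∷ []) ⟩
        P + 2 * v  ∎

    excess≡P : excess u v 1 ≡ P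
    excess≡P = excess-≡ P u v (trans P+u+v (sym (*-identityʳ (u * v))))

    excess≡Q : excess s t k ≡ Q
    excess≡Q = excess-≡ Q s t Q+s+t

    U : ℕ
    U = u ∸ 1

    u≡1+U : u ≡ 1 + U
    u≡1+U = sym (trans (+-comm 1 U) (m∸n+n≡m (≤-trans (s≤s z≤n) 2≤u)))

    Uv≡P+u : U * v ≡ P + u
    Uv≡P+u = +-cancelʳ-≡ v (U * v) (P + u) (begin
      U * v + v    ≡⟨ +-comm (U * v) v ⟩
      (1 + U) * v  ≡⟨ cong (_* v) (sym u≡1+U) ⟩
      u * v        ≡⟨ sym P+u+v ⟩
      P + u + v    ∎)
      where open ≡-Reasoning

    -- α = kP − uv and β = αs − P satisfy βt = Ps + 1, which forces t = tCandidate u v k s.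
    α : ℕ
    α = k * P ∸ u * v

    α-eq : 0 < α × α * (s * t) ≡ 1 + P * (s + t)
    α-eq = exact-difference (u * v) (k * P) (s * t) (begin
        k * P * (s * t)                     ≡⟨ solve (k ∷ P ∷ s ∷ t ∷ []) ⟩
        P * (s * t * k)                     ≡⟨ cong (P *_) (sym Q+s+t) ⟩
        P * (Q + s + t)                     ≡⟨ solve (P ∷ Q ∷ s ∷ t ∷ []) ⟩
        P * Q + P * (s + t)                 ≡⟨ cong (_+ P * (s + t)) PQ≡ ⟩
        u * v * (s * t) + 1 + P * (s + t)   ≡⟨ +-assoc (u * v * (s * t)) 1 (P * (s + t)) ⟩
        u * v * (s * t) + (1 + P * (s + t)) ∎)
      where open ≡-Reasoning

    β : ℕ
    β = α * s ∸ P

    β-eq : 0 < β × β * t ≡ 1 + P * s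
    β-eq = exact-difference P (α * s) t (begin
        α * s * t            ≡⟨ *-assoc α s t ⟩
        α * (s * t)          ≡⟨ proj₂ α-eq ⟩
        1 + P * (s + t)      ≡⟨ solve (P ∷ s ∷ t ∷ []) ⟩
        P * t + (1 + P * s)  ∎)
      where open ≡-Reasoning

    tCandidate≡t : tCandidate u v k s ≡ t
    tCandidate≡t = begin
      tCandidate u v k s   ≡⟨ cong (λ p → (p * s + 1) div ((k * p ∸ u * v) * s ∸ p)) excess≡P ⟩
      (P * s + 1) div β    ≡⟨ div-exact (proj₁ β-eq) (trans (*-comm t β) (trans (proj₂ β-eq) (+-comm 1 (P * s)))) ⟩
      t                    ∎
      where open ≡-Reasoning

    s≤2P : s ≤ 2 * P
    s≤2P = ≤-trans (m≤n*m s α {{>-nonZero (proj₁ α-eq)}}) αs≤2P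
      where
      αs≤2P : α * s ≤ 2 * P
      αs≤2P with α * s ≤? 2 * P
      ... | yes αs≤2P = αs≤2P
      ... | no αs≰2P = ⊥-elim (<⇒≱ 2≤t (+-cancelˡ-≤ (2 * P * t) t 1 (begin
          2 * P * t + t      ≡⟨ solve (P ∷ t ∷ []) ⟩
          (1 + 2 * P) * t    ≤⟨ *-monoˡ-≤ t (≰⇒> αs≰2P) ⟩
          α * s * t          ≡⟨ *-assoc α s t ⟩
          α * (s * t)        ≡⟨ proj₂ α-eq ⟩
          1 + P * (s + t)    ≤⟨ +-monoʳ-≤ 1 (*-monoʳ-≤ P (+-monoˡ-≤ t s≤t)) ⟩
          1 + P * (t + t)    ≡⟨ solve (P ∷ t ∷ []) ⟩
          2 * P * t + 1      ∎)))
        where open ≤-Reasoning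

    -- m = Uk − u, D = ms − U and F = Dt − Us satisfy Fv = uQ + 1, which forces v = vCandidate u k s t.
    m : ℕ
    m = gap u k

    m-eq : 0 < m × m * (v * (s * t)) ≡ 1 + u * Q + U * v * (s + t)
    m-eq = exact-difference u (U * k) (v * (s * t)) (identity U Uv≡P+u)
      where
      identity : ∀ x → x * v ≡ P + u → x * k * (v * (s * t)) ≡ u * (v * (s * t)) + (1 + u * Q + x * v * (s + t))
      identity x xv≡P+u = begin
        x * k * (v * (s * t))              ≡⟨ solve (x ∷ k ∷ v ∷ s ∷ t ∷ []) ⟩
        x * v * (s * t * k)                ≡⟨ cong (x * v *_) (sym Q+s+t) ⟩
        x * v * (Q + s + t)                ≡⟨ solve (x ∷ v ∷ Q ∷ s ∷ t ∷ []) ⟩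
        x * v * Q + x * v * (s + t)        ≡⟨ cong (λ y → y * Q + x * v * (s + t)) xv≡P+u ⟩
        (P + u) * Q + x * v * (s + t)      ≡⟨ solve (P ∷ u ∷ Q ∷ x ∷ v ∷ s ∷ t ∷ []) ⟩
        P * Q + (u * Q + x * v * (s + t))  ≡⟨ cong (_+ (u * Q + x * v * (s + t))) PQ≡ ⟩
        u * v * (s * t) + 1 + (u * Q + x * v * (s + t)) ≡⟨ solve (u ∷ v ∷ s ∷ t ∷ Q ∷ x ∷ []) ⟩
        u * (v * (s * t)) + (1 + u * Q + x * v * (s + t)) ∎
        where open ≡-Reasoning

    D : ℕ
    D = m * s ∸ U

    D-eq : 0 < D × D * (v * t) ≡ 1 + u * Q + U * v * s
    D-eq = exact-difference U (m * s) (v * t) (identity m U (proj₂ m-eq))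
      where
      identity : ∀ x y → x * (v * (s * t)) ≡ 1 + u * Q + y * v * (s + t) →
                 x * s * (v * t) ≡ y * (v * t) + (1 + u * Q + y * v * s)
      identity x y eq = begin
        x * s * (v * t)              ≡⟨ solve (x ∷ s ∷ v ∷ t ∷ []) ⟩
        x * (v * (s * t))            ≡⟨ eq ⟩
        1 + u * Q + y * v * (s + t)  ≡⟨ solve (u ∷ Q ∷ y ∷ v ∷ s ∷ t ∷ []) ⟩
        y * (v * t) + (1 + u * Q + y * v * s) ∎
        where open ≡-Reasoning

    F : ℕ
    F = D * t ∸ U * s

    F-eq : 0 < F × F * v ≡ 1 + u * Q
    F-eq = exact-difference (U * s) (D * t) v (identity D U (proj₂ D-eq))
      where
      identity : ∀ x y → x * (v * t) ≡ 1 + u * Q + y * v * s → x * t * v ≡ y * s * v + (1 + u * Q)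
      identity x y eq = begin
        x * t * v              ≡⟨ solve (x ∷ t ∷ v ∷ []) ⟩
        x * (v * t)            ≡⟨ eq ⟩
        1 + u * Q + y * v * s  ≡⟨ solve (u ∷ Q ∷ y ∷ v ∷ s ∷ []) ⟩
        y * s * v + (1 + u * Q) ∎
        where open ≡-Reasoning

    vCandidate≡v : vCandidate u k s t ≡ v
    vCandidate≡v = begin
      vCandidate u k s t     ≡⟨ cong (λ q → (u * q + 1) div F) excess≡Q ⟩
      (u * Q + 1) div F      ≡⟨ div-exact (proj₁ F-eq) (trans (*-comm v F) (trans (proj₂ F-eq) (+-comm 1 (u * Q)))) ⟩
      v                      ∎
      where open ≡-Reasoning

    Q≤stk : Q ≤ s * t * k
    Q≤stk = subst (Q ≤_) Q+s+t (≤-trans (m≤m+n Q s) (m≤m+n (Q + s) t))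

    -- 2m·vst = mv·st + ms·vt; the next two lemmas compare this with 2(1 + uQ + Uv(s + t)), resp. 2D·vt.
    mv≤2uk : 4 * U ≤ m * s → m * v ≤ 2 * u * k
    mv≤2uk 4U≤ms with m * v ≤? 2 * u * k
    ... | yes mv≤2uk = mv≤2uk
    ... | no mv≰2uk = ⊥-elim (<⇒≱ (≤-trans (m≤m+n 3 1) 4≤st)
            (+-cancelˡ-≤ (2 * u * k * (s * t) + 4 * U * (v * t)) (s * t) 2
            (bound U m (≰⇒> mv≰2uk) 4U≤ms (proj₂ m-eq))))
      where
      bound : ∀ x y → 1 + 2 * u * k ≤ y * v → 4 * x ≤ y * s → y * (v * (s * t)) ≡ 1 + u * Q + x * v * (s + t) →
              2 * u * k * (s * t) + 4 * x * (v * t) + s * t ≤ 2 * u * k * (s * t) + 4 * x * (v * t) + 2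
      bound x y 2uk<yv 4x≤ys y-eq = begin
        2 * u * k * (s * t) + 4 * x * (v * t) + s * t   ≡⟨ solve (u ∷ k ∷ s ∷ t ∷ x ∷ v ∷ []) ⟩
        (1 + 2 * u * k) * (s * t) + 4 * x * (v * t)
          ≤⟨ +-mono-≤ (*-monoˡ-≤ (s * t) 2uk<yv) (*-monoˡ-≤ (v * t) 4x≤ys) ⟩
        y * v * (s * t) + y * s * (v * t)               ≡⟨ solve (y ∷ v ∷ s ∷ t ∷ []) ⟩
        2 * (y * (v * (s * t)))                         ≡⟨ cong (2 *_) y-eq ⟩
        2 * (1 + u * Q + x * v * (s + t))               ≤⟨ *-monoʳ-≤ 2 (+-mono-≤ (+-monoʳ-≤ 1 (*-monoʳ-≤ u Q≤stk))
                                                              (*-monoʳ-≤ (x * v) (+-monoˡ-≤ t s≤t))) ⟩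
        2 * (1 + u * (s * t * k) + x * v * (t + t))     ≡⟨ solve (u ∷ s ∷ t ∷ k ∷ x ∷ v ∷ []) ⟩
        2 * u * k * (s * t) + 4 * x * (v * t) + 2       ∎
        where open ≤-Reasoning

    Dt≤2Us : D * v ≰ 2 * u * k * s → D * t ≤ 2 * U * s
    Dt≤2Us Dv≰2uks with D * t ≤? 2 * U * s
    ... | yes Dt≤2Us = Dt≤2Us
    ... | no Dt≰2Us = ⊥-elim (<⇒≱ (≤-trans (m≤m+n 3 1) (≤-trans (+-mono-≤ 2≤t 2≤v) (m≤m+n (t + v) _)))
            (+-cancelˡ-≤ (2 * (u * Q) + 2 * (U * v * s)) _ 2 (bound U D (≰⇒> Dv≰2uks) (≰⇒> Dt≰2Us) (proj₂ D-eq))))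
      where
      bound : ∀ x y → 1 + 2 * u * k * s ≤ y * v → 1 + 2 * x * s ≤ y * t → y * (v * t) ≡ 1 + u * Q + x * v * s →
              2 * (u * Q) + 2 * (x * v * s) + (t + v + (2 * (u * s) + 2 * (u * t)))
                ≤ 2 * (u * Q) + 2 * (x * v * s) + 2
      bound x y 2uks<yv 2xs<yt y-eq = begin
        2 * (u * Q) + 2 * (x * v * s) + (t + v + (2 * (u * s) + 2 * (u * t)))
                                                    ≡⟨ solve (u ∷ Q ∷ x ∷ v ∷ s ∷ t ∷ []) ⟩
        2 * u * (Q + s + t) + 2 * (x * v * s) + (t + v) ≡⟨ cong (λ n → 2 * u * n + 2 * (x * v * s) + (t + v)) Q+s+t ⟩
        2 * u * (s * t * k) + 2 * (x * v * s) + (t + v) ≡⟨ solve (u ∷ s ∷ t ∷ k ∷ x ∷ v ∷ []) ⟩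
        (1 + 2 * u * k * s) * t + (1 + 2 * x * s) * v ≤⟨ +-mono-≤ (*-monoˡ-≤ t 2uks<yv) (*-monoˡ-≤ v 2xs<yt) ⟩
        y * v * t + y * t * v                       ≡⟨ solve (y ∷ v ∷ t ∷ []) ⟩
        2 * (y * (v * t))                           ≡⟨ cong (2 *_) y-eq ⟩
        2 * (1 + u * Q + x * v * s)                 ≡⟨ solve (u ∷ Q ∷ x ∷ v ∷ s ∷ []) ⟩
        2 * (u * Q) + 2 * (x * v * s) + 2           ∎
        where open ≤-Reasoning

    s-small : 4 * U ≰ m * s → s ≤ (4 * U ∸ 1) div m
    s-small 4U≰ms = ≤-div (proj₁ m-eq) (m+n≤o⇒m≤o∸n (m * s) (subst (_≤ 4 * U) (+-comm 1 (m * s)) (≰⇒> 4U≰ms)))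

    isSolution-holds : T (isSolution (u , v , k , s , t))
    isSolution-holds = Equivalence.from T-∧ (≤⇒≤ᵇ 2≤u , Equivalence.from T-∧ (≤⇒≤ᵇ u≤v ,
      Equivalence.from T-∧ (≤⇒≤ᵇ 2≤s , Equivalence.from T-∧ (≤⇒≤ᵇ s≤t ,
      ≡⇒≡ᵇ _ _ (trans (cong₂ _*_ excess≡P excess≡Q) PQ≡)))))

    listed : (u , v , k , s , t) ∈ solutions
    listed = checked-sound found isSolution-holds
      where
      open Searched (search-sound u≤14 k≤7)
      found : T (checked (u , v , k , s , t))
      found = by-cases (4 * U ≤? m * s) (D * v ≤? 2 * u * k * s)
        where
        by-cases : Dec (4 * U ≤ m * s) → Dec (D * v ≤ 2 * u * k * s) → T (checked (u , v , k , s , t))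
        by-cases (yes 4U≤ms) _ = subst (λ t′ → T (checked (u , v , k , s , t′))) tCandidate≡t
          (t-from-v,s (≤-div (proj₁ m-eq) (mv≤2uk 4U≤ms))
            (subst (λ p → s ≤ 2 * p) (sym excess≡P) s≤2P))
        by-cases (no 4U≰ms) (yes Dv≤2uks) = subst (λ t′ → T (checked (u , v , k , s , t′))) tCandidate≡t
          (t-from-s,v (s-small 4U≰ms) (≤-div (proj₁ D-eq) Dv≤2uks))
        by-cases (no 4U≰ms) (no Dv≰2uks) = subst (λ v′ → T (checked (u , v′ , k , s , t))) vCandidate≡v
          (v-from-s,t (s-small 4U≰ms) (≤-div (proj₁ D-eq) (Dt≤2Us Dv≰2uks)))

  sorted-solution-listed : ∀ {u v k s t} → Solution u v 1 k s t → u ≤ v → s ≤ t → (u , v , k , s , t) ∈ solutions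
  sorted-solution-listed {u} {v} sol u≤v s≤t =
    SortedSolution.listed 2≤a u≤v 2≤e s≤t (centre-one⇒other-centre≥2 sol)
      (trans P+a+b (*-identityʳ (u * v))) Q+e+f PQ≡
    where open Solution sol

module Classification where

  open NaturalSolutions
  open AdmissibleLabellings
  open Search
  open Bounds
  open import Data.Bool using (T; T?)
  open import Data.Integer as ℤ using (ℤ; +_; +≤+)
  import Data.Integer.Properties as ℤ
  open import Data.List using (List; []; _∷_; map)
  open import Data.List.Membership.Propositional using (_∈_)
  open import Data.List.Membership.Propositional.Properties using (∈-map⁺)
  open import Data.List.Relation.Unary.All using (All; []; _∷_; all?)
  open import Data.List.Relation.Unary.AllPairs as AllPairs using (AllPairs; allPairs?)
  import Data.Nat as ℕ
  open import Data.Nat.Properties using (≰⇒≥)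
  open import Data.Product using (∃; ∃₂; _×_; _,_; proj₁)
  open import Data.Sum using (inj₁; inj₂)
  open import Function using (_∘_)
  open import Relation.Binary.PropositionalEquality
  open import Relation.Nullary using (¬_; yes; no; ¬?)
  open import Relation.Nullary.Decidable using (from-yes)

  toLabels : Candidate → Labels
  toLabels (u , v , k , s , t) = lab (+ u) (+ v) (+ 1) (+ k) (+ s) (+ t)

  representatives : List Labels
  representatives = map toLabels solutions

  Classified : Labels → Set
  Classified x = ∃ λ r → r ∈ representatives × Equiv x r

  classified-after-step : ∀ {x y} → Step x y → Classified y → Classified x
  classified-after-step step (r , r∈ , y≈r) = r , r∈ , eq-step step y≈r

  listed⇒classified : ∀ {c} → c ∈ solutions → Classified (toLabels c)
  listed⇒classified c∈ = _ , ∈-map⁺ toLabels c∈ , eq-refl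

  centred-classified : ∀ {a b d e f} → Solution a b 1 d e f → Classified (lab (+ a) (+ b) (+ 1) (+ d) (+ e) (+ f))
  centred-classified {a} {b} {d} {e} {f} sol with a ℕ.≤? b | e ℕ.≤? f
  ... | yes a≤b | yes e≤f = listed⇒classified (sorted-solution-listed sol a≤b e≤f)
  ... | no a≰b | yes e≤f =
    classified-after-step swap12 (listed⇒classified (sorted-solution-listed (swap-ab sol) (≰⇒≥ a≰b) e≤f))
  ... | yes a≤b | no e≰f =
    classified-after-step swap56 (listed⇒classified (sorted-solution-listed (swap-ef sol) a≤b (≰⇒≥ e≰f)))
  ... | no a≰b | no e≰f = classified-after-step swap12 (classified-after-step swap56
          (listed⇒classified (sorted-solution-listed (swap-ef (swap-ab sol)) (≰⇒≥ a≰b) (≰⇒≥ e≰f))))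

  solution-classified : ∀ {a b c d e f} → Solution a b c d e f → Classified (lab (+ a) (+ b) (+ c) (+ d) (+ e) (+ f))
  solution-classified sol with central-label-one sol
  ... | inj₁ refl = centred-classified sol
  ... | inj₂ refl = classified-after-step flipH (centred-classified (flip sol))

  admissible-classified : ∀ x → Admissible x → Classified x
  admissible-classified (lab _ _ c d _ _) (+≤+ 2≤a , +≤+ 2≤b , +≤+ 2≤e , +≤+ 2≤f , posDef , det≡1) =
    by-solution (admissible⇒solution c d 2≤a 2≤b 2≤e 2≤f posDef det≡1)
    where
    by-solution : ∀ {a b c d e f} → (∃₂ λ c′ d′ → c ≡ + c′ × d ≡ + d′ × Solution a b c′ d′ e f) →
                  Classified (lab (+ a) (+ b) c d (+ e) (+ f))
    by-solution (_ , _ , refl , refl , sol) = solution-classified sol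

  armWeight : ℤ → ℤ → ℤ → ℤ
  armWeight centre x y = centre ℤ.* (x ℤ.+ y) ℤ.+ + 1000 ℤ.* (x ℤ.* y)

  armWeight-swap : ∀ centre x y → armWeight centre x y ≡ armWeight centre y x
  armWeight-swap centre x y = cong₂ (λ σ π → centre ℤ.* σ ℤ.+ + 1000 ℤ.* π) (ℤ.+-comm x y) (ℤ.*-comm x y)

  -- Preserved by the automorphisms of the H-graph, and injective on the representatives.
  invariant : Labels → ℤ
  invariant (lab a b c d e f) = armWeight c a b ℤ.+ armWeight d e f

  step-invariant : ∀ {x y} → Step x y → invariant x ≡ invariant y
  step-invariant (swap12 {a} {b} {c} {d} {e} {f}) = cong (ℤ._+ armWeight d e f) (armWeight-swap c a b)
  step-invariant (swap56 {a} {b} {c} {d} {e} {f}) = cong (λ w → armWeight c a b ℤ.+ w) (armWeight-swap d e f)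
  step-invariant (flipH {a} {b} {c} {d} {e} {f}) = ℤ.+-comm (armWeight c a b) (armWeight d e f)

  Equiv-invariant : ∀ {x y} → Equiv x y → invariant x ≡ invariant y
  Equiv-invariant eq-refl = refl
  Equiv-invariant (eq-step step x≈y) = trans (step-invariant step) (Equiv-invariant x≈y)
  Equiv-invariant (eq-stepᵒ step x≈y) = trans (sym (step-invariant step)) (Equiv-invariant x≈y)

  representatives-inequivalent : AllPairs (λ x y → ¬ Equiv x y) representatives
  representatives-inequivalent = AllPairs.map (λ invariants≢ → invariants≢ ∘ Equiv-invariant)
    (from-yes (allPairs? (λ x y → ¬? (invariant x ℤ.≟ invariant y)) representatives))

  -- The implicit arguments are given because inferring them would unfold PosDef.
  candidate-admissible : ∀ c → T (isSolution c) → Admissible (toLabels c)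
  candidate-admissible (u , v , k , s , t) isSol =
    solution⇒admissible {u} {v} {1} {k} {s} {t} (proj₁ (isSolution-sound isSol))

  candidates-admissible : ∀ cs → All (T ∘ isSolution) cs → All Admissible (map toLabels cs)
  candidates-admissible [] [] = []
  candidates-admissible (c ∷ cs) (isSol ∷ isSols) = candidate-admissible c isSol ∷ candidates-admissible cs isSols

  representatives-admissible : All Admissible representatives
  representatives-admissible = candidates-admissible solutions (from-yes (all? (T? ∘ isSolution) solutions))

open Classification

theorem1p2 : ExactlyClasses 39
theorem1p2 =
  representatives , refl , representatives-admissible , representatives-inequivalent , admissible-classified
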